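{- There is a fixed singly exponential function $g$ such that the following holds. Let $\mathcal{F}$ be a $Y$-bounded frame over $\Sigma$ of dimension $N$, and let $Z$ be a positive integer. Then $\mathcal{F}$ has a $Z$-solution if and only if it has a $Z$-solution $\bar w$ every component of which is at most $g(L+M^*+N+\log Y+\log Z)$.
   Context: $\Sigma$ is a finite signature of unary and binary predicates (no constants, no function symbols) with distinguished binary "counting predicates" $f_1,\dots,f_m$. A 1-type is a maximal consistent set of equality-free literals in the variable $x$ only; enumerate the 1-types over $\Sigma$ as $\pi_1,\dots,\pi_L$. A 2-type is a maximal consistent set of equality-free literals in $x,y$; $\tau^{ -1}$ swaps $x,y$; $\mathrm{tp}_1(\tau)$ is the 1-type contained in $\tau$, $\mathrm{tp}_2(\tau)=\mathrm{tp}_1(\tau^{ -1})$. A 2-type $\tau$ is a message-type if $f_h(x,y)\in\tau$ for some $h$; invertible if $\tau,\tau^{ -1}$ are both message-types; silent if neither is; $\Xi$ is the set of silent 2-types. Enumerate the message-types as $\mu_1,\dots,\mu_M$, the invertible ones being exactly $\mu_1,\dots,\mu_{M^*}$. A star-type is a pair $\sigma=\langle\pi,\bar v\rangle$, $\pi$ a 1-type, $\bar v\in\mathbb N^M$, with $v_j>0$ implying $\mathrm{tp}_1(\mu_j)=\pi$; write $\mathrm{tp}(\sigma)=\pi$, $\sigma[j]=v_j$. A frame is $\mathcal F=(\bar\sigma,I,\theta)$ where $\bar\sigma=(\sigma_1,\dots,\sigma_N)$ is a list of pairwise distinct star-types ($N$ is the dimension), $I\subseteq\{\{i,i'\}:1\le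 i\le i'\le L\}$, and $\theta:I\to\Xi$ with $\mathrm{tp}_1(\theta(\{i,i'\}))=\pi_i$, $\mathrm{tp}_2(\theta(\{i,i'\}))=\pi_{i'}$ for $i\le i'$. $\mathcal F$ is $Y$-bounded if $\sigma_k[j]\le Y$ for all $k,j$. For $1\le i\le L$, $1\le j\le M$, $1\le k\le N$: $o_{ik}=1$ if $\mathrm{tp}(\sigma_k)=\pi_i$, else $0$; $p_{ik}=1$ if $\sigma_k[j]=0$ for all $j$ with $\mathrm{tp}_2(\mu_j)=\pi_i$, else $0$; $q_{jk}=\sigma_k[j]$; $r_{ik}=\sum\{\sigma_k[j]:M^*<j\le M,\ \mathrm{tp}_2(\mu_j)=\pi_i\}$; $s_{ik}=\sum\{\sigma_k[j]:1\le j\le M,\ \mathrm{tp}_2(\mu_j)=\pi_i\}$. For $\bar w=(w_1,\dots,w_N)$ of positive integers: $u_i=\sum_k o_{ik}w_k$, $v_j=\sum_k q_{jk}w_k$ ($1\le j\le M^*$), $x_{ii'}=\sum_k o_{ik}p_{i'k}w_k$. For a positive integer $Z$, $\bar w$ is a $Z$-solution of $\mathcal F$ if for all $i,i'\in\{1..L\}$, $j\in\{1..M^*\}$, $k\in\{1..N\}$: (C1) $v_j=v_{j'}$ where $\mu_{j'}=\mu_j^{ -1}$; (C2) $s_{ik}\le u_i$; (C3) $u_i\le1$ or $u_i>Z$; (C4) if $o_{ik}=1$ then $u_i>1$ or $r_{i'k}\le x_{i'i}$; (C5) if $\{i,i'\}\notin I$ then $u_i\le1$ or $u_{i'}\le1$;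 (C6) if $\{i,i'\}\notin I$ and $o_{ik}=1$ then $u_i>1$ or $r_{i'k}\ge x_{i'i}$. -}

module Defs where

open import Data.Nat using (ℕ; zero; suc; _+_; _*_; _^_; _≤_; _<_)
open import Data.Nat.Logarithm using (⌈log₂_⌉)
open import Data.Bool using (Bool; true; false; if_then_else_; _∧_)
import Data.Bool as B
open import Data.Fin using (Fin; toℕ)
import Data.Fin as F
open import Data.Vec using (Vec; lookup)
import Data.Vec.Properties as VP
import Data.Product.Properties as PP
open import Data.Product using (Σ; ∃; ∃-syntax; _×_; _,_; proj₁; proj₂)
open import Data.Sum using (_⊎_)
open import Relation.Nullary using (¬_; Dec; does)
open import Relation.Binary.PropositionalEquality using (_≡_; _≢_)
open import Function.Bundles using (_⇔_)

-- Signatures: nU unary and nB binary predicates; the counting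
-- predicates f_1..f_m are the binary predicates h with cnt h = true.

record Signature : Set where
  field
    nU  : ℕ
    nB  : ℕ
    cnt : Vec Bool nB
open Signature public

-- A 1-type in x: truth values of U(x) for unary U and R(x,x) for binary R.
OneType : Signature → Set
OneType S = Vec Bool (nU S) × Vec Bool (nB S)

dec₁ : (S : Signature) → (a b : OneType S) → Dec (a ≡ b)
dec₁ S = PP.≡-dec (VP.≡-dec B._≟_) (VP.≡-dec B._≟_)

-- A 2-type in x,y: the 1-type of x, the 1-type of y (literals in y only),
-- and truth values of R(x,y) and R(y,x) for each binary R.
record TwoType (S : Signature) : Set where
  constructor mk2
  field
    tp₁ : OneType S
    tp₂ : OneType S
    xy  : Vec Bool (nB S)
    yx  : Vec Bool (nB S)
open TwoType public

inv : {S : Signature} → TwoType S → TwoType S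
inv (mk2 a b r r') = mk2 b a r' r

IsMsg : {S : Signature} → TwoType S → Set
IsMsg {S} τ = ∃[ h ] (lookup (cnt S) h ≡ true × lookup (xy τ) h ≡ true)

IsSilent : {S : Signature} → TwoType S → Set
IsSilent τ = ¬ IsMsg τ × ¬ IsMsg (inv τ)

-- Enumerations π_1..π_L of the 1-types and μ_1..μ_M of the
-- message-types, the invertible ones being exactly μ_1..μ_{M*}.
-- (Indices are 0-based: Fin L, Fin M.)

record Enumeration (S : Signature) : Set where
  field
    L      : ℕ
    π      : Fin L → OneType S
    π-inj  : ∀ i i' → π i ≡ π i' → i ≡ i'
    π-surj : ∀ (t : OneType S) → ∃[ i ] (π i ≡ t)
    M      : ℕ
    M*     : ℕ
    M*≤M   : M* ≤ M
    μ      : Fin M → TwoType S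
    μ-inj  : ∀ j j' → μ j ≡ μ j' → j ≡ j'
    μ-msg  : ∀ j → IsMsg (μ j)
    μ-surj : ∀ (τ : TwoType S) → IsMsg τ → ∃[ j ] (μ j ≡ τ)
    μ-invertible : ∀ j → (toℕ j < M* ⇔ IsMsg (inv (μ j)))
open Enumeration public

∑ : (n : ℕ) → (Fin n → ℕ) → ℕ
∑ zero    f = 0
∑ (suc n) f = f F.zero + ∑ n (λ k → f (F.suc k))

⟦_⟧ : Bool → ℕ
⟦ true ⟧  = 1
⟦ false ⟧ = 0

module _ {S : Signature} (E : Enumeration S) where

  record StarType : Set where
    constructor ⟨_,_⟩∣_
    field
      tp  : Fin (L E)
      vec : Vec ℕ (M E)
      wf  : ∀ j → 0 < lookup vec j → tp₁ (μ E j) ≡ π E tp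
  open StarType public

  _[_] : StarType → Fin (M E) → ℕ
  σ [ j ] = lookup (vec σ) j

  SameStar : StarType → StarType → Set
  SameStar σ σ' = tp σ ≡ tp σ' × vec σ ≡ vec σ'

  -- I is a set of unordered pairs {i,i'} (i ≤ i' allowed equal),
  -- represented as a symmetric Boolean relation on Fin L.
  record Frame : Set where
    field
      N        : ℕ
      σ        : Fin N → StarType
      distinct : ∀ k k' → k ≢ k' → ¬ SameStar (σ k) (σ k')
      I        : Fin (L E) → Fin (L E) → Bool
      I-sym    : ∀ i i' → I i i' ≡ I i' i
      θ        : ∀ i i' → i F.≤ i' → I i i' ≡ true →
                 Σ (TwoType S) λ τ →
                   IsSilent τ × tp₁ τ ≡ π E i × tp₂ τ ≡ π E i'
  open Frame public

  Bounded : ℕ → Frame → Set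
  Bounded Y F = ∀ k j → σ F k [ j ] ≤ Y

  module Coeffs (F : Frame) where
    Ln = L E
    Mn = M E

    o : Fin Ln → Fin (N F) → ℕ
    o i k = ⟦ does (tp (σ F k) F.≟ i) ⟧

    pb : (n : ℕ) → (Fin n → Bool) → Bool
    pb zero    f = true
    pb (suc n) f = f F.zero ∧ pb n (λ j → f (F.suc j))

    p : Fin Ln → Fin (N F) → ℕ
    p i k = ⟦ pb Mn (λ j → if does (dec₁ S (tp₂ (μ E j)) (π E i))
                           then does (σ F k [ j ] Data.Nat.≟ 0)
                           else true) ⟧

    q : Fin Mn → Fin (N F) → ℕ
    q j k = σ F k [ j ]

    -- r_{ik}: sum over non-invertible j (M* < j, 1-based) with tp₂(μ_j) = π_i
    r : Fin Ln → Fin (N F) → ℕ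
    r i k = ∑ Mn (λ j → ⟦ does (M* E Data.Nat.≤? toℕ j) ∧ does (dec₁ S (tp₂ (μ E j)) (π E i)) ⟧
                         * σ F k [ j ])

    s : Fin Ln → Fin (N F) → ℕ
    s i k = ∑ Mn (λ j → ⟦ does (dec₁ S (tp₂ (μ E j)) (π E i)) ⟧ * σ F k [ j ])

    module _ (w : Fin (N F) → ℕ) where
      u : Fin Ln → ℕ
      u i = ∑ (N F) (λ k → o i k * w k)

      v : Fin Mn → ℕ     -- used only for invertible j (toℕ j < M*)
      v j = ∑ (N F) (λ k → q j k * w k)

      x : Fin Ln → Fin Ln → ℕ
      x i i' = ∑ (N F) (λ k → o i k * p i' k * w k)

  record IsSolution (F : Frame) (Z : ℕ) (w : Fin (N F) → ℕ) : Set where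
    open Coeffs F
    field
      positive : ∀ k → 0 < w k
      C1 : ∀ j j' → toℕ j < M* E → μ E j' ≡ inv (μ E j) → v w j ≡ v w j'
      C2 : ∀ i k → s i k ≤ u w i
      C3 : ∀ i → u w i ≤ 1 ⊎ Z < u w i
      C4 : ∀ i i' k → o i k ≡ 1 → 1 < u w i ⊎ r i' k ≤ x w i' i
      C5 : ∀ i i' → I F i i' ≡ false → u w i ≤ 1 ⊎ u w i' ≤ 1
      C6 : ∀ i i' k → I F i i' ≡ false → o i k ≡ 1 →
           1 < u w i ⊎ x w i' i ≤ r i' k

SinglyExponential : (ℕ → ℕ) → Set
SinglyExponential g = ∃[ c ] (∀ n → g n ≤ 2 ^ ((n + c) ^ c))

-- Let w be a Z-solution and T = Z + M·Y + 1. Every lower bound demanded by C2–C4 (and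
-- u_i > Z, u_i ≥ 2) is at most T, so it survives when w is replaced by any w' with
-- w ⊓ T ≤ w' ≤ w; the upper bounds in C3, C5, C6 survive any decrease. Only the linear
-- equations C1 must be kept, and they say that w is balanced: P · w = Q · w for
-- matrices P, Q with entries ≤ Y. Write w = R + e with R = w ⊓ T; then e is balanced up
-- to β = N·Y·T. If some e_k₀ exceeds W^{M*}, walk along the scaled path ⌊t·e/e_k₀⌋,
-- 0 ≤ t ≤ e_k₀: every point on it is balanced up to N·Y + β, so its vector of
-- discrepancies takes fewer than W^{M*} values (W = 2(N·Y + β) + 1), and by pigeonhole
-- two points collide. Their difference y ≤ e is balanced and nonzero at k₀, so w - y is
-- a smaller solution. Iterating yields a solution bounded by T + W^{M*}, which is singly
-- exponential since M ≤ L⁴.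

module Submission where

open import Defs
open import Data.Bool using (Bool; true; false; _∧_)
open import Data.Fin as Fin using (Fin; toℕ; fromℕ<; funToFin; finToFun)
open import Data.Fin.Patterns using (0F; 1F; 2F; 3F)
import Data.Fin.Properties as Finₚ
open import Data.List using ([]; _∷_)
open import Data.Nat
open import Data.Nat.DivMod
open import Data.Nat.Induction using (<-wellFounded)
open import Data.Nat.Logarithm using (⌈log₂_⌉)
open import Data.Nat.Logarithm.Core using (⌈log2⌉)
open import Data.Nat.Properties
open import Algebra.Properties.CommutativeMonoid.Sum +-0-commutativeMonoid as +-Sum using ()
open import Algebra.Properties.Semiring.Sum +-*-semiring as *-Sum using ()
open import Data.Nat.Tactic.RingSolver using (solve)
open import Data.Product using (∃-syntax; _×_; _,_; proj₁; proj₂)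
open import Data.Sum using (inj₁; inj₂) renaming (map to ⊎-map)
open import Data.Vec using (Vec; replicate)
open import Function.Base using (_∘_)
open import Function.Bundles using (_⇔_; mk⇔; Equivalence)
open import Induction.WellFounded using (Acc; acc)
open import Relation.Nullary using (yes; no; does)
open import Relation.Binary.PropositionalEquality

∑≡sum : ∀ n (f : Fin n → ℕ) → ∑ n f ≡ +-Sum.sum f
∑≡sum zero    f = refl
∑≡sum (suc n) f = cong (f Fin.zero +_) (∑≡sum n (f ∘ Fin.suc))

∑-cong : ∀ n {f g : Fin n → ℕ} → (∀ k → f k ≡ g k) → ∑ n f ≡ ∑ n g
∑-cong zero    f≗g = refl
∑-cong (suc n) f≗g = cong₂ _+_ (f≗g Fin.zero) (∑-cong n (f≗g ∘ Fin.suc))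

∑-distrib-+ : ∀ n (f g : Fin n → ℕ) → ∑ n (λ k → f k + g k) ≡ ∑ n f + ∑ n g
∑-distrib-+ n f g
  rewrite ∑≡sum n (λ k → f k + g k) | ∑≡sum n f | ∑≡sum n g = +-Sum.∑-distrib-+ f g

*-distribˡ-∑ : ∀ n c (f : Fin n → ℕ) → ∑ n (λ k → c * f k) ≡ c * ∑ n f
*-distribˡ-∑ n c f
  rewrite ∑≡sum n (λ k → c * f k) | ∑≡sum n f = sym (*-Sum.*-distribˡ-sum c f)

∑-mono-≤ : ∀ n {f g : Fin n → ℕ} → (∀ k → f k ≤ g k) → ∑ n f ≤ ∑ n g
∑-mono-≤ zero    f≤g = z≤n
∑-mono-≤ (suc n) f≤g = +-mono-≤ (f≤g Fin.zero) (∑-mono-≤ n (f≤g ∘ Fin.suc))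

∑-≤-* : ∀ n {f : Fin n → ℕ} {b} → (∀ k → f k ≤ b) → ∑ n f ≤ n * b
∑-≤-* zero    f≤b = z≤n
∑-≤-* (suc n) f≤b = +-mono-≤ (f≤b Fin.zero) (∑-≤-* n (f≤b ∘ Fin.suc))

f≤∑ : ∀ n (f : Fin n → ℕ) k → f k ≤ ∑ n f
f≤∑ (suc n) f Fin.zero    = m≤m+n _ _
f≤∑ (suc n) f (Fin.suc k) = ≤-trans (f≤∑ n (f ∘ Fin.suc) k) (m≤n+m _ _)

∑-∸ : ∀ n {w y : Fin n → ℕ} → (∀ k → y k ≤ w k) →
      ∑ n (λ k → w k ∸ y k) + ∑ n y ≡ ∑ n w
∑-∸ n {w} {y} y≤w =
  trans (sym (∑-distrib-+ n _ y)) (∑-cong n (λ k → m∸n+n≡m (y≤w k)))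

∑-∸-< : ∀ n {w y : Fin n → ℕ} → (∀ k → y k ≤ w k) → ∀ k₀ → 0 < y k₀ →
        ∑ n (λ k → w k ∸ y k) < ∑ n w
∑-∸-< n {w} {y} y≤w k₀ 0<y₀ = begin-strict
  ∑ n (λ k → w k ∸ y k)         <⟨ m<m+n _ (<-≤-trans 0<y₀ (f≤∑ n y k₀)) ⟩
  ∑ n (λ k → w k ∸ y k) + ∑ n y ≡⟨ ∑-∸ n y≤w ⟩
  ∑ n w                         ∎
  where open ≤-Reasoning

[m+n]⊓o≤m⊓o+n⊓o : ∀ m n o → (m + n) ⊓ o ≤ m ⊓ o + n ⊓ o
[m+n]⊓o≤m⊓o+n⊓o m n o with ≤-total m o
... | inj₁ m≤o rewrite m≤n⇒m⊓n≡m m≤o = begin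
  (m + n) ⊓ o       ≤⟨ ⊓-monoʳ-≤ (m + n) (m≤n+m o m) ⟩
  (m + n) ⊓ (m + o) ≡⟨ +-distribˡ-⊓ m n o ⟨
  m + n ⊓ o         ∎
  where open ≤-Reasoning
... | inj₂ o≤m rewrite m≥n⇒m⊓n≡n o≤m = ≤-trans (m⊓n≤n (m + n) o) (m≤m+n o (n ⊓ o))

[m*n]⊓o≤m*[n⊓o] : ∀ m n o → (m * n) ⊓ o ≤ m * (n ⊓ o)
[m*n]⊓o≤m*[n⊓o] zero    n o = z≤n
[m*n]⊓o≤m*[n⊓o] (suc m) n o =
  ≤-trans ([m+n]⊓o≤m⊓o+n⊓o n (m * n) o) (+-monoʳ-≤ (n ⊓ o) ([m*n]⊓o≤m*[n⊓o] m n o))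

[∑f]⊓t≤∑[f⊓t] : ∀ n (f : Fin n → ℕ) t → ∑ n f ⊓ t ≤ ∑ n (λ k → f k ⊓ t)
[∑f]⊓t≤∑[f⊓t] zero    f t = z≤n
[∑f]⊓t≤∑[f⊓t] (suc n) f t =
  ≤-trans ([m+n]⊓o≤m⊓o+n⊓o (f Fin.zero) _ t)
          (+-monoʳ-≤ (f Fin.zero ⊓ t) ([∑f]⊓t≤∑[f⊓t] n (f ∘ Fin.suc) t))

infix 7 _·_

_·_ : ∀ {n} → (Fin n → ℕ) → (Fin n → ℕ) → ℕ
_·_ {n} c w = ∑ n (λ k → c k * w k)

module _ {n : ℕ} where

  ·-mono-≤ : ∀ c {w w' : Fin n → ℕ} → (∀ k → w k ≤ w' k) → c · w ≤ c · w'
  ·-mono-≤ c w≤w' = ∑-mono-≤ n (λ k → *-monoʳ-≤ (c k) (w≤w' k))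

  ·-distrib-+ : ∀ c (w w' : Fin n → ℕ) → c · (λ k → w k + w' k) ≡ c · w + c · w'
  ·-distrib-+ c w w' =
    trans (∑-cong n (λ k → *-distribˡ-+ (c k) (w k) (w' k))) (∑-distrib-+ n _ _)

  ·-scale : ∀ c t (w : Fin n → ℕ) → c · (λ k → t * w k) ≡ t * (c · w)
  ·-scale c t w = trans (∑-cong n (λ k → x*[y*z]≡y*[x*z] (c k) t (w k))) (*-distribˡ-∑ n t _)
    where
    x*[y*z]≡y*[x*z] : ∀ x y z → x * (y * z) ≡ y * (x * z)
    x*[y*z]≡y*[x*z] x y z = solve (x ∷ y ∷ z ∷ [])

  ·-∸ : ∀ c {w y : Fin n → ℕ} → (∀ k → y k ≤ w k) → c · (λ k → w k ∸ y k) + c · y ≡ c · w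
  ·-∸ c y≤w =
    trans (cong (_+ c · _) (∑-cong n (λ k → *-distribˡ-∸ (c k) _ _)))
          (∑-∸ n (λ k → *-monoʳ-≤ (c k) (y≤w k)))

  ·-≤-* : ∀ {c w : Fin n → ℕ} {a b} → (∀ k → c k ≤ a) → (∀ k → w k ≤ b) → c · w ≤ n * (a * b)
  ·-≤-* c≤a w≤b = ∑-≤-* n (λ k → *-mono-≤ (c≤a k) (w≤b k))

  [c·w]⊓t≤c·[w⊓t] : ∀ c (w : Fin n → ℕ) t → (c · w) ⊓ t ≤ c · (λ k → w k ⊓ t)
  [c·w]⊓t≤c·[w⊓t] c w t =
    ≤-trans ([∑f]⊓t≤∑[f⊓t] n _ t) (∑-mono-≤ n (λ k → [m*n]⊓o≤m*[n⊓o] (c k) (w k) t))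

[m+o]∸n≡[m'+o]∸n'⇒m+n'≡m'+n : ∀ {m m' n n' o} → n ≤ m + o → n' ≤ m' + o →
                               (m + o) ∸ n ≡ (m' + o) ∸ n' → m + n' ≡ m' + n
[m+o]∸n≡[m'+o]∸n'⇒m+n'≡m'+n {m} {m'} {n} {n'} {o} n≤ n'≤ eq = +-cancelʳ-≡ o _ _ (begin
  m + n' + o             ≡⟨ +-comm (m + n') o ⟩
  o + (m + n')           ≡⟨ +-assoc o m n' ⟨
  o + m + n'             ≡⟨ cong (_+ n') (+-comm o m) ⟩
  m + o + n'             ≡⟨ cong (_+ n') (m∸n+n≡m n≤) ⟨
  (m + o) ∸ n + n + n'   ≡⟨ cong (λ d → d + n + n') eq ⟩
  (m' + o) ∸ n' + n + n' ≡⟨ swap ((m' + o) ∸ n') n n' ⟩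
  (m' + o) ∸ n' + n' + n ≡⟨ cong (_+ n) (m∸n+n≡m n'≤) ⟩
  m' + o + n             ≡⟨ swap m' o n ⟩
  m' + n + o             ∎)
  where
  open ≡-Reasoning
  swap : ∀ x y z → x + y + z ≡ x + z + y
  swap x y z = solve (x ∷ y ∷ z ∷ [])

x+a≡a'∧y+b≡b'∧a+b'≡a'+b⇒x≡y : ∀ {x y a a' b b'} → x + a ≡ a' → y + b ≡ b' →
                               a + b' ≡ a' + b → x ≡ y
x+a≡a'∧y+b≡b'∧a+b'≡a'+b⇒x≡y {x} {y} {a} {b = b} refl refl cross =
  +-cancelʳ-≡ (a + b) x y (begin
    x + (a + b)   ≡⟨ +-assoc x a b ⟨
    x + a + b     ≡⟨ cross ⟨
    a + (y + b)   ≡⟨ +-assoc a y b ⟨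
    a + y + b     ≡⟨ cong (_+ b) (+-comm a y) ⟩
    y + a + b     ≡⟨ +-assoc y a b ⟩
    y + (a + b)   ∎)
  where open ≡-Reasoning

n<2^n : ∀ n → n < 2 ^ n
n<2^n zero    = z<s
n<2^n (suc n) = begin-strict
  suc n           ≤⟨ n<2^n n ⟩
  2 ^ n           <⟨ m<m+n (2 ^ n) (m^n>0 2 n) ⟩
  2 ^ n + 2 ^ n   ≡⟨ cong (2 ^ n +_) (+-identityʳ (2 ^ n)) ⟨
  2 ^ suc n       ∎
  where open ≤-Reasoning

n≤2^⌈log₂n⌉ : ∀ n → n ≤ 2 ^ ⌈log₂ n ⌉
n≤2^⌈log₂n⌉ n = go n (<-wellFounded n)
  where
  go : ∀ n (rec : Acc _<_ n) → n ≤ 2 ^ ⌈log2⌉ n rec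
  go 0             _         = z≤n
  go 1             _         = ≤-refl
  go (suc (suc n)) (acc rec) = begin
    2 + n                    ≤⟨ +-monoʳ-≤ 2 n≤h+h ⟩
    2 + (h + h)              ≡⟨ double h ⟩
    2 * suc h                ≤⟨ *-monoʳ-≤ 2 (go (suc h) _) ⟩
    2 * 2 ^ ⌈log2⌉ (suc h) _ ∎
    where
    open ≤-Reasoning
    h = ⌈ n /2⌉
    n≤h+h : n ≤ h + h
    n≤h+h = ≤-trans (≤-reflexive (sym (⌊n/2⌋+⌈n/2⌉≡n n))) (+-monoˡ-≤ h (⌊n/2⌋≤⌈n/2⌉ n))
    double : ∀ h → 2 + (h + h) ≡ 2 * suc h
    double h = solve (h ∷ [])

[a+2]*[12a+8]≤[a+4]^4 : ∀ a → (a + 2) * suc (12 * a + 7) ≤ (a + 4) ^ 4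
[a+2]*[12a+8]≤[a+4]^4 a = ≤-trans (m≤m+n ((a + 2) * suc (12 * a + 7)) _) (≤-reflexive (expand a))
  where
  expand : ∀ a → (a + 2) * suc (12 * a + 7) + (a * a * a * a + 16 * (a * a * a) + 84 * (a * a) + 224 * a + 240)
                 ≡ (a + 4) * ((a + 4) * ((a + 4) * ((a + 4) * 1)))
  expand a = solve (a ∷ [])

module PowerBounds (A : ℕ) (2≤A : 2 ≤ A) where

  instance
    A≢0 : NonZero A
    A≢0 = >-nonZero (≤-trans (s≤s z≤n) 2≤A)

  +-≤-^ : ∀ {x y} i j → x ≤ A ^ i → y ≤ A ^ j → x + y ≤ A ^ suc (i ⊔ j)
  +-≤-^ {x} {y} i j x≤ y≤ = begin
    x + y                     ≤⟨ +-mono-≤ (≤-trans x≤ (^-monoʳ-≤ A (m≤m⊔n i j)))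
                                          (≤-trans y≤ (^-monoʳ-≤ A (m≤n⊔m i j))) ⟩
    A ^ (i ⊔ j) + A ^ (i ⊔ j) ≡⟨ cong (A ^ (i ⊔ j) +_) (+-identityʳ _) ⟨
    2 * A ^ (i ⊔ j)           ≤⟨ *-monoˡ-≤ (A ^ (i ⊔ j)) 2≤A ⟩
    A ^ suc (i ⊔ j)           ∎
    where open ≤-Reasoning

  *-≤-^ : ∀ {x y} i j → x ≤ A ^ i → y ≤ A ^ j → x * y ≤ A ^ (i + j)
  *-≤-^ i j x≤ y≤ = ≤-trans (*-mono-≤ x≤ y≤) (≤-reflexive (sym (^-distribˡ-+-* A i j)))

  ^-≤-^ : ∀ {x} i e → x ≤ A ^ i → x ^ e ≤ A ^ (i * e)
  ^-≤-^ i e x≤ = ≤-trans (^-monoˡ-≤ e x≤) (≤-reflexive (^-*-assoc A i e))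

funToFin-injective : ∀ {m n} (f g : Fin m → Fin n) → funToFin f ≡ funToFin g → ∀ i → f i ≡ g i
funToFin-injective f g eq i = begin
  f i                    ≡⟨ Finₚ.finToFun-funToFin f i ⟨
  finToFun (funToFin f) i ≡⟨ cong (λ c → finToFun c i) eq ⟩
  finToFun (funToFin g) i ≡⟨ Finₚ.finToFun-funToFin g i ⟩
  g i                    ∎
  where open ≡-Reasoning

-- Balanced vectors

Balanced : ∀ {m n} → (P Q : Fin m → Fin n → ℕ) → (Fin n → ℕ) → Set
Balanced P Q w = ∀ r → P r · w ≡ Q r · w

balanced-∸ : ∀ {m n} {P Q : Fin m → Fin n → ℕ} {w y : Fin n → ℕ} →
             Balanced P Q w → Balanced P Q y → (∀ k → y k ≤ w k) →
             Balanced P Q (λ k → w k ∸ y k)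
balanced-∸ {P = P} {Q} {w} {y} bal-w bal-y y≤w r = +-cancelʳ-≡ (P r · y) _ _ (begin
  P r · d + P r · y ≡⟨ ·-∸ (P r) y≤w ⟩
  P r · w           ≡⟨ bal-w r ⟩
  Q r · w           ≡⟨ ·-∸ (Q r) y≤w ⟨
  Q r · d + Q r · y ≡⟨ cong (Q r · d +_) (bal-y r) ⟨
  Q r · d + P r · y ∎)
  where
  open ≡-Reasoning
  d = λ k → w k ∸ y k

digitBase : ℕ → ℕ
digitBase slack = suc (slack + slack)

module Balancing {m n : ℕ} (P Q : Fin m → Fin n → ℕ) {Y : ℕ}
                 (P≤Y : ∀ r k → P r k ≤ Y) (Q≤Y : ∀ r k → Q r k ≤ Y) (β : ℕ) where

  slack : ℕ
  slack = n * Y + β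

  NearlyBalanced : (Fin n → ℕ) → Set
  NearlyBalanced e = ∀ r → P r · e ≤ Q r · e + β × Q r · e ≤ P r · e + β

  module ScaledPath (e : Fin n → ℕ) (nearly : NearlyBalanced e)
                    (k₀ : Fin n) .{{_ : NonZero (e k₀)}} where

    T : ℕ
    T = e k₀

    path : ℕ → Fin n → ℕ
    path t k = t * e k / T

    path-mono : ∀ {t t'} → t ≤ t' → ∀ k → path t k ≤ path t' k
    path-mono t≤t' k = /-monoˡ-≤ T (*-monoˡ-≤ (e k) t≤t')

    path-end : ∀ k → path T k ≡ e k
    path-end k = trans (cong (_/ T) (*-comm T (e k))) (m*n/n≡m (e k) T)

    path-at-k₀ : ∀ t → path t k₀ ≡ t
    path-at-k₀ t = m*n/n≡m t T

    T*path≤t*e : ∀ t k → T * path t k ≤ t * e k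
    T*path≤t*e t k = ≤-trans (≤-reflexive (*-comm T (path t k))) (m/n*n≤m (t * e k) T)

    t*e≤T*path+T : ∀ t k → t * e k ≤ T * path t k + T
    t*e≤T*path+T t k = begin
      t * e k                    ≡⟨ m≡m%n+[m/n]*n (t * e k) T ⟩
      t * e k % T + path t k * T ≤⟨ +-monoˡ-≤ _ (<⇒≤ (m%n<n (t * e k) T)) ⟩
      T + path t k * T           ≡⟨ +-comm T _ ⟩
      path t k * T + T           ≡⟨ cong (_+ T) (*-comm (path t k) T) ⟩
      T * path t k + T           ∎
      where open ≤-Reasoning

    path-close : ∀ (A B : Fin n → ℕ) → (∀ k → B k ≤ Y) → A · e ≤ B · e + β →
                 ∀ {t} → t ≤ T → A · path t ≤ B · path t + slack
    path-close A B B≤Y A≤B+β {t} t≤T = *-cancelˡ-≤ T (begin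
      T * (A · path t)                                 ≡⟨ ·-scale A T (path t) ⟨
      A · (λ k → T * path t k)                         ≤⟨ ·-mono-≤ A (T*path≤t*e t) ⟩
      A · (λ k → t * e k)                              ≡⟨ ·-scale A t e ⟩
      t * (A · e)                                      ≤⟨ *-monoʳ-≤ t A≤B+β ⟩
      t * (B · e + β)                                  ≡⟨ *-distribˡ-+ t (B · e) β ⟩
      t * (B · e) + t * β                              ≡⟨ cong (_+ t * β) (·-scale B t e) ⟨
      B · (λ k → t * e k) + t * β                      ≤⟨ +-mono-≤ (·-mono-≤ B (t*e≤T*path+T t)) (*-monoˡ-≤ β t≤T) ⟩
      B · (λ k → T * path t k + T) + T * β             ≡⟨ cong (_+ T * β) (·-distrib-+ B _ _) ⟩
      B · (λ k → T * path t k) + B · (λ _ → T) + T * β ≤⟨ +-monoˡ-≤ (T * β) (+-monoʳ-≤ _ (·-≤-* B≤Y (λ _ → ≤-refl))) ⟩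
      B · (λ k → T * path t k) + n * (Y * T) + T * β   ≡⟨ cong (λ b → b + n * (Y * T) + T * β) (·-scale B T (path t)) ⟩
      T * (B · path t) + n * (Y * T) + T * β           ≡⟨ factor T (B · path t) n Y β ⟩
      T * (B · path t + slack)                         ∎)
      where
      open ≤-Reasoning
      factor : ∀ T b n Y β → T * b + n * (Y * T) + T * β ≡ T * (b + (n * Y + β))
      factor T b n Y β = solve (T ∷ b ∷ n ∷ Y ∷ β ∷ [])

    -- By path-close the subtraction never truncates, so equal digits give equal discrepancies.
    digit : ℕ → Fin m → ℕ
    digit t r = (P r · path t + slack) ∸ Q r · path t

    digit<base : ∀ {t} → t ≤ T → ∀ r → digit t r < digitBase slack
    digit<base {t} t≤T r = s≤s (m≤n+o⇒m∸n≤o _ (Q r · path t) (begin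
      P r · path t + slack           ≤⟨ +-monoˡ-≤ slack (path-close (P r) (Q r) (Q≤Y r) (proj₁ (nearly r)) t≤T) ⟩
      Q r · path t + slack + slack   ≡⟨ +-assoc (Q r · path t) slack slack ⟩
      Q r · path t + (slack + slack) ∎))
      where open ≤-Reasoning

    digitCode : Fin (suc T) → Fin (digitBase slack ^ m)
    digitCode i = funToFin (λ r → fromℕ< (digit<base (s≤s⁻¹ (Finₚ.toℕ<n i)) r))

    same-code⇒same-digits : ∀ {i j} → digitCode i ≡ digitCode j →
                            ∀ r → digit (toℕ i) r ≡ digit (toℕ j) r
    same-code⇒same-digits eq r = begin
      _                  ≡⟨ Finₚ.toℕ-fromℕ< _ ⟨
      toℕ (fromℕ< _)     ≡⟨ cong toℕ (funToFin-injective _ _ eq r) ⟩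
      toℕ (fromℕ< _)     ≡⟨ Finₚ.toℕ-fromℕ< _ ⟩
      _                  ∎
      where open ≡-Reasoning

    same-digits⇒balanced : ∀ {t t'} → t ≤ t' → t' ≤ T → (∀ r → digit t r ≡ digit t' r) →
                           Balanced P Q (λ k → path t' k ∸ path t k)
    same-digits⇒balanced t≤t' t'≤T same r =
      x+a≡a'∧y+b≡b'∧a+b'≡a'+b⇒x≡y (·-∸ (P r) (path-mono t≤t')) (·-∸ (Q r) (path-mono t≤t'))
        ([m+o]∸n≡[m'+o]∸n'⇒m+n'≡m'+n (close (≤-trans t≤t' t'≤T)) (close t'≤T) (same r))
      where
      close : ∀ {t} → t ≤ T → Q r · path t ≤ P r · path t + slack
      close = path-close (Q r) (P r) (P≤Y r) (proj₂ (nearly r))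

    collision⇒balanced-part : ∀ {i j} → i Fin.< j → digitCode i ≡ digitCode j →
                              ∃[ y ] ((∀ k → y k ≤ e k) × 0 < y k₀ × Balanced P Q y)
    collision⇒balanced-part {i} {j} i<j same =
      (λ k → path (toℕ j) k ∸ path (toℕ i) k) , y≤e , 0<y₀ ,
      same-digits⇒balanced (<⇒≤ i<j) j≤T (same-code⇒same-digits {i} {j} same)
      where
      j≤T : toℕ j ≤ T
      j≤T = s≤s⁻¹ (Finₚ.toℕ<n j)
      y≤e : ∀ k → path (toℕ j) k ∸ path (toℕ i) k ≤ e k
      y≤e k = ≤-trans (m∸n≤m (path (toℕ j) k) (path (toℕ i) k))
                      (≤-trans (path-mono j≤T k) (≤-reflexive (path-end k)))
      0<y₀ : 0 < path (toℕ j) k₀ ∸ path (toℕ i) k₀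
      0<y₀ = m<n⇒0<n∸m (subst₂ _<_ (sym (path-at-k₀ (toℕ i))) (sym (path-at-k₀ (toℕ j))) i<j)

  balanced-part : ∀ e → NearlyBalanced e → ∀ k₀ → digitBase slack ^ m < e k₀ →
                  ∃[ y ] ((∀ k → y k ≤ e k) × 0 < y k₀ × Balanced P Q y)
  balanced-part e nearly k₀ base^m<e₀ =
    let i , j , i<j , same = Finₚ.pigeonhole (m<n⇒m<1+n base^m<e₀) digitCode
    in collision⇒balanced-part i<j same
    where
    instance
      e₀≢0 : NonZero (e k₀)
      e₀≢0 = >-nonZero (<-≤-trans z<s base^m<e₀)
    open ScaledPath e nearly k₀

  module Reduction (R : Fin n → ℕ) (PR≤β : ∀ r → P r · R ≤ β) (QR≤β : ∀ r → Q r · R ≤ β) where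

    record Reduct (w : Fin n → ℕ) : Set where
      constructor reduct
      field
        vector   : Fin n → ℕ
        R≤vector : ∀ k → R k ≤ vector k
        vector≤w : ∀ k → vector k ≤ w k
        balanced : Balanced P Q vector
        close    : ∀ k → vector k ≤ R k + digitBase slack ^ m

    reduct-≤ : ∀ {w w₁} → (∀ k → w₁ k ≤ w k) → Reduct w₁ → Reduct w
    reduct-≤ w₁≤w (reduct v R≤v v≤w₁ bal close) =
      reduct v R≤v (λ k → ≤-trans (v≤w₁ k) (w₁≤w k)) bal close

    remainder-nearly-balanced : ∀ {w} → (∀ k → R k ≤ w k) → Balanced P Q w →
                                NearlyBalanced (λ k → w k ∸ R k)
    remainder-nearly-balanced {w} R≤w bal r =
      shift (P r) (Q r) (bal r) (QR≤β r) , shift (Q r) (P r) (sym (bal r)) (PR≤β r)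
      where
      d = λ k → w k ∸ R k
      shift : ∀ A B → A · w ≡ B · w → B · R ≤ β → A · d ≤ B · d + β
      shift A B Aw≡Bw BR≤β = begin
        A · d         ≤⟨ m≤m+n _ _ ⟩
        A · d + A · R ≡⟨ ·-∸ A R≤w ⟩
        A · w         ≡⟨ Aw≡Bw ⟩
        B · w         ≡⟨ ·-∸ B R≤w ⟨
        B · d + B · R ≤⟨ +-monoʳ-≤ (B · d) BR≤β ⟩
        B · d + β     ∎
        where open ≤-Reasoning

    reduce : ∀ w → Acc _<_ (∑ n w) → (∀ k → R k ≤ w k) → Balanced P Q w → Reduct w
    reduce w (acc smaller) R≤w bal with Finₚ.any? (λ k → digitBase slack ^ m <? w k ∸ R k)
    ... | no ¬far = reduct w R≤w (λ _ → ≤-refl) bal close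
      where
      close : ∀ k → w k ≤ R k + digitBase slack ^ m
      close k = begin
        w k               ≡⟨ m+[n∸m]≡n (R≤w k) ⟨
        R k + (w k ∸ R k) ≤⟨ +-monoʳ-≤ (R k) (≮⇒≥ (¬far ∘ (k ,_))) ⟩
        R k + digitBase slack ^ m ∎
        where open ≤-Reasoning
    ... | yes (k₀ , far) =
      descend (balanced-part _ (remainder-nearly-balanced R≤w bal) k₀ far)
      where
      descend : ∃[ y ] ((∀ k → y k ≤ w k ∸ R k) × 0 < y k₀ × Balanced P Q y) → Reduct w
      descend (y , y≤w∸R , 0<y₀ , bal-y) =
        reduct-≤ (λ k → m∸n≤m (w k) (y k))
          (reduce (λ k → w k ∸ y k) (smaller (∑-∸-< n y≤w k₀ 0<y₀)) R≤w∸y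
                  (balanced-∸ {P = P} {Q} bal bal-y y≤w))
        where
        y≤w : ∀ k → y k ≤ w k
        y≤w k = ≤-trans (y≤w∸R k) (m∸n≤m (w k) (R k))
        R≤w∸y : ∀ k → R k ≤ w k ∸ y k
        R≤w∸y k = m+n≤o⇒m≤o∸n (R k) (begin
          R k + y k         ≤⟨ +-monoʳ-≤ (R k) (y≤w∸R k) ⟩
          R k + (w k ∸ R k) ≡⟨ m+[n∸m]≡n (R≤w k) ⟩
          w k               ∎)
          where open ≤-Reasoning

-- Types, frames and solutions

module _ {S : Signature} (E : Enumeration S) where

  oneTypeIndex : OneType S → Fin (L E)
  oneTypeIndex t = proj₁ (π-surj E t)

  oneTypeIndex-injective : ∀ {t t'} → oneTypeIndex t ≡ oneTypeIndex t' → t ≡ t'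
  oneTypeIndex-injective {t} {t'} eq = begin
    t                     ≡⟨ proj₂ (π-surj E t) ⟨
    π E (oneTypeIndex t)  ≡⟨ cong (π E) eq ⟩
    π E (oneTypeIndex t') ≡⟨ proj₂ (π-surj E t') ⟩
    t'                    ∎
    where open ≡-Reasoning

  -- The atoms R(x,y), resp. R(y,x), of a 2-type are coded as the binary part of a 1-type.
  asOneType : Vec Bool (nB S) → OneType S
  asOneType atoms = replicate (nU S) false , atoms

  twoTypeCoordinates : TwoType S → Fin 4 → Fin (L E)
  twoTypeCoordinates τ 0F = oneTypeIndex (tp₁ τ)
  twoTypeCoordinates τ 1F = oneTypeIndex (tp₂ τ)
  twoTypeCoordinates τ 2F = oneTypeIndex (asOneType (xy τ))
  twoTypeCoordinates τ 3F = oneTypeIndex (asOneType (yx τ))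

  twoTypeCode : TwoType S → Fin (L E ^ 4)
  twoTypeCode = funToFin ∘ twoTypeCoordinates

  twoTypeCode-injective : ∀ {τ τ'} → twoTypeCode τ ≡ twoTypeCode τ' → τ ≡ τ'
  twoTypeCode-injective {τ@(mk2 a b c d)} {τ'@(mk2 a' b' c' d')} eq
    with same ← funToFin-injective (twoTypeCoordinates τ) (twoTypeCoordinates τ') eq
    with refl ← oneTypeIndex-injective {a} {a'} (same 0F)
       | refl ← oneTypeIndex-injective {b} {b'} (same 1F)
       | refl ← oneTypeIndex-injective {asOneType c} {asOneType c'} (same 2F)
       | refl ← oneTypeIndex-injective {asOneType d} {asOneType d'} (same 3F)
    = refl

  M≤L^4 : M E ≤ L E ^ 4
  M≤L^4 = Finₚ.injective⇒≤ {f = twoTypeCode ∘ μ E} (μ-inj E _ _ ∘ twoTypeCode-injective)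

⟦b⟧*n≤n : ∀ b n → ⟦ b ⟧ * n ≤ n
⟦b⟧*n≤n false n = z≤n
⟦b⟧*n≤n true  n = ≤-reflexive (+-identityʳ n)

-- Exceeds every lower bound occurring in C2–C4: s_{ik}, r_{ik} ≤ M·Y, and Z + 1.
threshold : (M Y Z : ℕ) → ℕ
threshold M Y Z = suc (Z + M * Y)

solutionBound : (M M* n Y Z : ℕ) → ℕ
solutionBound M M* n Y Z = T + digitBase (n * Y + n * (Y * T)) ^ M*
  where T = threshold M Y Z

module _ {S : Signature} {E : Enumeration S} (F : Frame E) where
  open Coeffs E F using (o; p; q; r; s; v)

  invertible : Fin (M* E) → Fin (M E)
  invertible j = Fin.inject≤ j (M*≤M E)

  invertible-< : ∀ j → toℕ (invertible j) < M* E
  invertible-< j = subst (_< M* E) (sym (Finₚ.toℕ-inject≤ j (M*≤M E))) (Finₚ.toℕ<n j)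

  private
    inverse-exists : ∀ j → ∃[ j' ] (μ E j' ≡ inv (μ E (invertible j)))
    inverse-exists j =
      μ-surj E _ (Equivalence.to (μ-invertible E (invertible j)) (invertible-< j))

  inverse : Fin (M* E) → Fin (M E)
  inverse j = proj₁ (inverse-exists j)

  inverse-μ : ∀ j → μ E (inverse j) ≡ inv (μ E (invertible j))
  inverse-μ j = proj₂ (inverse-exists j)

  invertibleCounts inverseCounts : Fin (M* E) → Fin (N F) → ℕ
  invertibleCounts j = q (invertible j)
  inverseCounts    j = q (inverse j)

  SatisfiesC1 : (Fin (N F) → ℕ) → Set
  SatisfiesC1 w = ∀ j j' → toℕ j < M* E → μ E j' ≡ inv (μ E j) → v w j ≡ v w j'

  C1⇒balanced : ∀ {w} → SatisfiesC1 w → Balanced invertibleCounts inverseCounts w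
  C1⇒balanced c1 j = c1 (invertible j) (inverse j) (invertible-< j) (inverse-μ j)

  balanced⇒C1 : ∀ {w} → Balanced invertibleCounts inverseCounts w → SatisfiesC1 w
  balanced⇒C1 {w} bal j j' j<M* μj'≡μj⁻¹ =
    subst₂ (λ a b → v w a ≡ v w b) invertible-i inverse-i (bal i)
    where
    i = fromℕ< j<M*
    invertible-i : invertible i ≡ j
    invertible-i = Finₚ.toℕ-injective
      (trans (Finₚ.toℕ-inject≤ i (M*≤M E)) (Finₚ.toℕ-fromℕ< j<M*))
    inverse-i : inverse i ≡ j'
    inverse-i = μ-inj E _ _
      (trans (inverse-μ i) (trans (cong (inv ∘ μ E) invertible-i) (sym μj'≡μj⁻¹)))

  module _ {Y Z : ℕ} (bounded : Bounded E Y F) (0<Z : 0 < Z) where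

    private
      T = threshold (M E) Y Z

    selected-count≤threshold : ∀ (b : Fin (M E) → Bool) k → ∑ (M E) (λ j → ⟦ b j ⟧ * q j k) ≤ T
    selected-count≤threshold b k = m≤n⇒m≤1+n
      (≤-trans (∑-≤-* (M E) (λ j → ≤-trans (⟦b⟧*n≤n (b j) _) (bounded k j))) (m≤n+m _ Z))

    s≤T : ∀ i k → s i k ≤ T
    s≤T i k = selected-count≤threshold (λ j → does (dec₁ S (tp₂ (μ E j)) (π E i))) k

    r≤T : ∀ i k → r i k ≤ T
    r≤T i k = selected-count≤threshold
      (λ j → does (M* E ≤? toℕ j) ∧ does (dec₁ S (tp₂ (μ E j)) (π E i))) k

    module _ {w w' : Fin (N F) → ℕ} (w⊓T≤w' : ∀ k → w k ⊓ T ≤ w' k) (w'≤w : ∀ k → w' k ≤ w k) where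

      lower-bound-kept : ∀ c {b} → b ≤ T → b ≤ c · w → b ≤ c · w'
      lower-bound-kept c b≤T b≤c·w =
        ≤-trans (⊓-glb b≤c·w b≤T) (≤-trans ([c·w]⊓t≤c·[w⊓t] c w T) (·-mono-≤ c w⊓T≤w'))

      upper-bound-kept : ∀ c {b} → c · w ≤ b → c · w' ≤ b
      upper-bound-kept c = ≤-trans (·-mono-≤ c w'≤w)

      shrink-solution : IsSolution E F Z w → Balanced invertibleCounts inverseCounts w' →
                        IsSolution E F Z w'
      shrink-solution sol bal = record
        { positive = λ k → ≤-trans (⊓-glb (positive k) z<s) (w⊓T≤w' k)
        ; C1 = balanced⇒C1 bal
        ; C2 = λ i k → lower-bound-kept (o i) (s≤T i k) (C2 i k)
        ; C3 = λ i → ⊎-map (upper-bound-kept (o i)) (lower-bound-kept (o i) Z<T) (C3 i)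
        ; C4 = λ i i' k oᵢₖ → ⊎-map (lower-bound-kept (o i) 2≤T)
                                    (lower-bound-kept (λ k → o i' k * p i k) (r≤T i' k))
                                    (C4 i i' k oᵢₖ)
        ; C5 = λ i i' ∉I → ⊎-map (upper-bound-kept (o i)) (upper-bound-kept (o i')) (C5 i i' ∉I)
        ; C6 = λ i i' k ∉I oᵢₖ → ⊎-map (lower-bound-kept (o i) 2≤T)
                                       (upper-bound-kept (λ k → o i' k * p i k))
                                       (C6 i i' k ∉I oᵢₖ)
        }
        where
        open IsSolution sol
        Z<T : Z < T
        Z<T = s≤s (m≤m+n Z _)
        2≤T : 2 ≤ T
        2≤T = s≤s (≤-trans 0<Z (m≤m+n Z _))

    small-solution : ∀ {w} → IsSolution E F Z w →
                     ∃[ w' ] (IsSolution E F Z w' × ∀ k → w' k ≤ solutionBound (M E) (M* E) (N F) Y Z)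
    small-solution {w} sol = vector , shrink-solution R≤vector vector≤w sol balanced , bound
      where
      R = λ k → w k ⊓ T
      R·≤ : ∀ {c} → (∀ k → c k ≤ Y) → c · R ≤ N F * (Y * T)
      R·≤ c≤Y = ·-≤-* c≤Y (λ k → m⊓n≤n (w k) T)
      open Balancing invertibleCounts inverseCounts
        (λ j k → bounded k (invertible j)) (λ j k → bounded k (inverse j)) (N F * (Y * T))
      open Reduction R (λ j → R·≤ (λ k → bounded k (invertible j)))
                       (λ j → R·≤ (λ k → bounded k (inverse j)))
      open Reduct (reduce w (<-wellFounded _) (λ k → m⊓n≤m (w k) T)
                    (C1⇒balanced (IsSolution.C1 sol)))
      bound : ∀ k → vector k ≤ solutionBound (M E) (M* E) (N F) Y Z
      bound k = ≤-trans (close k) (+-monoˡ-≤ _ (m⊓n≤n (w k) T))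

-- The size bound

module _ {A : ℕ} (2≤A : 2 ≤ A) where
  open PowerBounds A 2≤A

  solutionBound≤A^[12a+8] : ∀ {L M M* n Y Z} a → L ≤ A ^ 1 → n ≤ A ^ 1 → Y ≤ A ^ 1 → Z ≤ A ^ 1 →
                            M* ≤ a → M ≤ L ^ 4 → solutionBound M M* n Y Z ≤ A ^ suc (12 * a + 7)
  solutionBound≤A^[12a+8] {L} {M} {M*} {n} {Y} {Z} a L≤A n≤A Y≤A Z≤A M*≤a M≤L⁴ = begin
    T + W ^ M*           ≤⟨ +-≤-^ 7 (12 * a) T≤A⁷ W^M*≤A^[12a] ⟩
    A ^ suc (7 ⊔ 12 * a) ≤⟨ ^-monoʳ-≤ A (s≤s (⊔-lub (m≤n+m 7 (12 * a)) (m≤m+n (12 * a) 7))) ⟩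
    A ^ suc (12 * a + 7) ∎
    where
    open ≤-Reasoning
    T : ℕ
    T = threshold M Y Z
    W : ℕ
    W = digitBase (n * Y + n * (Y * T))
    T≤A⁷ : T ≤ A ^ 7
    T≤A⁷ = +-≤-^ 0 6 ≤-refl (+-≤-^ 1 5 Z≤A (*-≤-^ 4 1 (≤-trans M≤L⁴ (^-≤-^ 1 4 L≤A)) Y≤A))
    slack≤A¹⁰ : n * Y + n * (Y * T) ≤ A ^ 10
    slack≤A¹⁰ = +-≤-^ 2 9 (*-≤-^ 1 1 n≤A Y≤A) (*-≤-^ 1 8 n≤A (*-≤-^ 1 7 Y≤A T≤A⁷))
    W≤A¹² : W ≤ A ^ 12
    W≤A¹² = +-≤-^ 0 11 ≤-refl (+-≤-^ 10 10 slack≤A¹⁰ slack≤A¹⁰)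
    W^M*≤A^[12a] : W ^ M* ≤ A ^ (12 * a)
    W^M*≤A^[12a] = ≤-trans (^-≤-^ 12 M* W≤A¹²) (^-monoʳ-≤ A (*-monoʳ-≤ 12 M*≤a))

expBound : ℕ → ℕ
expBound a = 2 ^ ((a + 4) ^ 4)

solutionBound≤expBound : ∀ L {M} M* n Y Z → M ≤ L ^ 4 →
  solutionBound M M* n Y Z ≤ expBound (L + M* + n + ⌈log₂ Y ⌉ + ⌈log₂ Z ⌉)
solutionBound≤expBound L {M} M* n Y Z M≤L⁴ = begin
  solutionBound M M* n Y Z         ≤⟨ solutionBound≤A^[12a+8] 2≤A a L≤A n≤A Y≤A Z≤A M*≤a M≤L⁴ ⟩
  A ^ suc (12 * a + 7)             ≡⟨ ^-*-assoc 2 (a + 2) (suc (12 * a + 7)) ⟩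
  2 ^ ((a + 2) * suc (12 * a + 7)) ≤⟨ ^-monoʳ-≤ 2 ([a+2]*[12a+8]≤[a+4]^4 a) ⟩
  expBound a                       ∎
  where
  open ≤-Reasoning
  a : ℕ
  a = L + M* + n + ⌈log₂ Y ⌉ + ⌈log₂ Z ⌉
  A : ℕ
  A = 2 ^ (a + 2)
  2≤A : 2 ≤ A
  2≤A = ^-monoʳ-≤ 2 (≤-trans (s≤s z≤n) (m≤n+m 2 a))
  2^[a+2]≡A¹ : 2 ^ (a + 2) ≡ A ^ 1
  2^[a+2]≡A¹ = sym (*-identityʳ A)
  ≤a⇒≤A : ∀ {x} → x ≤ a → x ≤ A ^ 1
  ≤a⇒≤A x≤a = ≤-trans (<⇒≤ (<-≤-trans (≤-<-trans x≤a (n<2^n a)) (^-monoʳ-≤ 2 (m≤m+n a 2))))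
                      (≤-reflexive 2^[a+2]≡A¹)
  ⌈log₂⌉≤a⇒≤A : ∀ x → ⌈log₂ x ⌉ ≤ a → x ≤ A ^ 1
  ⌈log₂⌉≤a⇒≤A x log≤a = ≤-trans (n≤2^⌈log₂n⌉ x)
    (≤-trans (^-monoʳ-≤ 2 (≤-trans log≤a (m≤m+n a 2))) (≤-reflexive 2^[a+2]≡A¹))
  L≤A : L ≤ A ^ 1
  L≤A = ≤a⇒≤A (m≤n⇒m≤n+o ⌈log₂ Z ⌉ (m≤n⇒m≤n+o ⌈log₂ Y ⌉ (m≤n⇒m≤n+o n (m≤m+n L M*))))
  M*≤a : M* ≤ a
  M*≤a = m≤n⇒m≤n+o ⌈log₂ Z ⌉ (m≤n⇒m≤n+o ⌈log₂ Y ⌉ (m≤n⇒m≤n+o n (m≤n+m M* L)))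
  n≤A : n ≤ A ^ 1
  n≤A = ≤a⇒≤A (m≤n⇒m≤n+o ⌈log₂ Z ⌉ (m≤n⇒m≤n+o ⌈log₂ Y ⌉ (m≤n+m n (L + M*))))
  Y≤A : Y ≤ A ^ 1
  Y≤A = ⌈log₂⌉≤a⇒≤A Y (m≤n⇒m≤n+o ⌈log₂ Z ⌉ (m≤n+m ⌈log₂ Y ⌉ (L + M* + n)))
  Z≤A : Z ≤ A ^ 1
  Z≤A = ⌈log₂⌉≤a⇒≤A Z (m≤n+m ⌈log₂ Z ⌉ (L + M* + n + ⌈log₂ Y ⌉))

lemma44 : ∃[ g ] (SinglyExponential g ×
              (∀ (S : Signature) (E : Enumeration S) (Y : ℕ) (F : Frame E) (Z : ℕ) →
                0 < Z → Bounded E Y F →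
                ((∃[ w ] IsSolution E F Z w) ⇔
                 (∃[ w ] (IsSolution E F Z w ×
                   (∀ k → w k ≤ g (L E + M* E + N F + ⌈log₂ Y ⌉ + ⌈log₂ Z ⌉)))))))
lemma44 = expBound , (4 , λ _ → ≤-refl) , λ S E Y F Z 0<Z bounded → mk⇔
  (λ (w , sol) →
    let w' , sol' , w'≤ = small-solution F bounded 0<Z sol
    in w' , sol' , λ k → ≤-trans (w'≤ k) (solutionBound≤expBound (L E) (M* E) (N F) Y Z (M≤L^4 E)))
  (λ (w , sol , _) → w , sol)
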